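{- Consider the goldbug system: every positive integer $i\ge1$ carries an arrow, Inbound or Outbound; $0$ and $-1$ are cups. A bug released at site $1$ moves as follows: at site $i\ge1$ it first flips the arrow at $i$, then hops to $i-2$ if the arrow now points Inbound and to $i+1$ if it now points Outbound; it stops upon reaching $0$ or $-1$. Let $\phi_-=(1-\sqrt5)/2$ and $\phi_+=(1+\sqrt5)/2$. For a configuration of arrows with only finitely many Inbound arrows, define its value $V=\sum_{i\ge1,\ \text{arrow at } i \text{ Inbound}}\phi_-^{\,i}$. Then for every such configuration, $V\neq 1/\phi_+-1$, and a single bug released at $1$ into this configuration lands in the cup at $0$ if $V<1/\phi_+-1$, and in the cup at $-1$ if $V>1/\phi_+-1$. -}

module Defs where

open import Data.Nat as ℕ using (ℕ; zero; suc)
open import Data.Integer as ℤ using (ℤ; +_; -[1+_])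
open import Data.Product using (_×_; _,_; proj₁; ∃)
open import Data.Sum using (_⊎_)
open import Relation.Binary.PropositionalEquality using (_≡_)
open import Relation.Nullary using (yes; no)

data Arrow : Set where
  Inbound Outbound : Arrow

flipArrow : Arrow → Arrow
flipArrow Inbound  = Outbound
flipArrow Outbound = Inbound

-- A configuration assigns an arrow to every site i ≥ 1.
-- (The value at index 0 is irrelevant: it is never read or changed.)
Config : Set
Config = ℕ → Arrow

flipAt : ℕ → Config → Config
flipAt i c j with i ℕ.≟ j
... | yes _ = flipArrow (c j)
... | no  _ = c j

InboundBoundedBy : Config → ℕ → Set
InboundBoundedBy c N = ∀ i → N ℕ.< i → c i ≡ Outbound

State : Set
State = ℤ × Config

hop : ℕ → Arrow → ℤ
hop i Inbound  = (+ i) ℤ.- (+ 2)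
hop i Outbound = (+ i) ℤ.+ (+ 1)

step : State → State
step (+ zero    , c) = (+ zero , c)
step (-[1+ n ]  , c) = (-[1+ n ] , c)
step (+ (suc k) , c) = hop (suc k) (c' (suc k)) , c'
  where c' = flipAt (suc k) c

run : ℕ → State → State
run zero    s = s
run (suc n) s = run n (step s)

LandsIn : ℤ → Config → Set
LandsIn z c = ∃ λ n → proj₁ (run n (+ 1 , c)) ≡ z

-- Exact arithmetic in ℤ[φ₋] ⊂ ℝ, where φ₋ = (1 - √5)/2.
-- A pair (a , b) stands for the real number a + b·φ₋.
-- Since 1 and φ₋ are linearly independent over ℚ, equality of reals
-- is equality of the pairs.

record Zφ : Set where
  constructor _+φ_
  field
    re : ℤ
    im : ℤ
open Zφ public

0φ : Zφ
0φ = (+ 0) +φ (+ 0)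

1φ : Zφ
1φ = (+ 1) +φ (+ 0)

_⊕_ : Zφ → Zφ → Zφ
(a +φ b) ⊕ (c +φ d) = (a ℤ.+ c) +φ (b ℤ.+ d)

_⊖_ : Zφ → Zφ → Zφ
(a +φ b) ⊖ (c +φ d) = (a ℤ.- c) +φ (b ℤ.- d)

-- φ₋² = φ₋ + 1, hence φ₋·(a + bφ₋) = b + (a + b)φ₋
timesφ : Zφ → Zφ
timesφ (a +φ b) = b +φ (a ℤ.+ b)

φ₋^ : ℕ → Zφ
φ₋^ zero    = 1φ
φ₋^ (suc i) = timesφ (φ₋^ i)

-- Positivity of the real number p + q·√5 (p q : ℤ)
PosSqrt5 : ℤ → ℤ → Set
PosSqrt5 p q =
     (+ 0 ℤ.≤ p × + 0 ℤ.≤ q × (+ 0 ℤ.< p ⊎ + 0 ℤ.< q))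
  ⊎ ((+ 0 ℤ.< p × q ℤ.< + 0) × ((+ 5) ℤ.* (q ℤ.* q) ℤ.< p ℤ.* p))
  ⊎ ((p ℤ.< + 0 × + 0 ℤ.< q) × (p ℤ.* p ℤ.< (+ 5) ℤ.* (q ℤ.* q)))

-- a + b·φ₋ = ((2a + b) + (-b)·√5) / 2, so it is positive iff
-- (2a + b) + (-b)·√5 is positive.
Positive : Zφ → Set
Positive (a +φ b) = PosSqrt5 ((+ 2) ℤ.* a ℤ.+ b) (ℤ.- b)

_<φ_ : Zφ → Zφ → Set
x <φ y = Positive (y ⊖ x)

-- The value V = Σ_{1 ≤ i, arrow at i Inbound} φ₋^i, computed as a finite
-- sum over 1 ≤ i ≤ N (all arrows beyond N being Outbound).

contrib : Arrow → ℕ → Zφ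
contrib Inbound  i = φ₋^ i
contrib Outbound i = 0φ

value : Config → ℕ → Zφ
value c zero    = 0φ
value c (suc n) = value c n ⊕ contrib (c (suc n)) (suc n)

-- The threshold 1/φ₊ - 1.  Since φ₊·φ₋ = -1 we have 1/φ₊ = -φ₋,
-- so 1/φ₊ - 1 = -1 - φ₋.
threshold : Zφ
threshold = (ℤ.- (+ 1)) +φ (ℤ.- (+ 1))

{-# OPTIONS --safe #-}
-- Write ψ = φ₋, so that 1/φ₊ = -ψ and ψ² = 1 + ψ. Seen from site j, the
-- arrows have the tail value T_j = Σ_{t ≥ 0} [arrow at j + t is Inbound] ψ^t,
-- which obeys T_j = [arrow at j is Inbound] + ψ T_{j+1} and lies strictly
-- between -1 and φ₊. By induction on the number of sites that may still be
-- Inbound, a bug released at j lands at j - 1 if T_j > 1/φ₊ and at j - 2 if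
-- T_j < 1/φ₊, leaving the arrows below j untouched. An Outbound arrow at j
-- sends it to j - 2 at once, and then T_j = ψ T_{j+1} < -ψ. An Inbound arrow
-- sends it to j + 1; since u ↦ 1 + ψu is decreasing and fixes 1/φ₊, the bug
-- comes back to j (whose arrow is now Outbound, so it moves on to j - 2)
-- exactly when T_j < 1/φ₊, and otherwise passes straight to j - 1. At j = 1
-- the criterion reads V = ψ T_1 ≶ ψ/φ₊ = 1/φ₊ - 1.
-- Comparisons in ℤ[ψ] are exact through x = (p + q√5)/2: all that is needed
-- is that multiplication by 1/φ₊ = (√5 - 1)/2 preserves positivity.
module Submission where

open import Defs
open import Data.Nat using (ℕ)
open import Data.Integer using (+_; -[1+_])
open import Data.Product using (_×_)
open import Relation.Nullary using (¬_)
open import Relation.Binary.PropositionalEquality using (_≡_)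

open import Data.Nat.Base as ℕ using (zero; suc; z≤n; s≤s)
import Data.Nat.Properties as ℕP
open import Data.Integer.Base as ℤ using (ℤ; _+_; _-_; _*_; -_; _≤_; _<_; +≤+; +<+; -<+)
open import Data.Integer.Properties
  using (≤-trans; <-≤-trans; ≤-<-trans; <⇒≤; <⇒≱; ≤⇒≯; ≮⇒≥; <-asym; _<?_;
         +-monoˡ-<; +-monoˡ-≤; +-mono-<; +-mono-<-≤; +-mono-≤-<;
         +-identityˡ; +-identityʳ; +-inverseʳ; i≤j⇒0≤j-i; 0≤i-j⇒j≤i;
         neg-mono-≤; neg-mono-<; neg-cancel-<; positive⁻¹;
         *-zeroʳ; *-monoˡ-≤-nonNeg; *-monoʳ-≤-nonNeg; *-monoˡ-<-pos;
         *-cancelˡ-≤-pos; *-cancelˡ-<-nonNeg)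
open import Data.Integer.Tactic.RingSolver using (solve)
open import Data.List.Base using (_∷_; [])
open import Data.Product as Product using (_,_; proj₁; ∃)
open import Data.Sum as Sum using (_⊎_; inj₁; inj₂)
open import Data.Empty using (⊥-elim)
open import Function using (_∘_; const; id)
open import Relation.Nullary using (yes; no; contradiction)
open import Relation.Binary.PropositionalEquality
  using (_≢_; refl; sym; trans; cong; cong₂; subst; subst₂; module ≡-Reasoning)

0<-resp-≡ : ∀ {i j} → + 0 < i → i ≡ j → + 0 < j
0<-resp-≡ 0<i refl = 0<i

0≤-resp-≡ : ∀ {i j} → + 0 ≤ i → i ≡ j → + 0 ≤ j
0≤-resp-≡ 0≤i refl = 0≤i

i<j⇒0<j-i : ∀ {i j} → i < j → + 0 < j - i
i<j⇒0<j-i {i} {j} i<j = subst (_< j - i) (+-inverseʳ i) (+-monoˡ-< (- i) i<j)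

0<i-j⇒j<i : ∀ {i j} → + 0 < i - j → j < i
0<i-j⇒j<i {i} {j} 0<i-j = subst₂ _<_ (+-identityˡ j) i-j+j≡i (+-monoˡ-< j 0<i-j)
  where
  i-j+j≡i : i - j + j ≡ i
  i-j+j≡i = solve (i ∷ j ∷ [])

0<-i⇒i<0 : ∀ {i} → + 0 < - i → i < + 0
0<-i⇒i<0 = neg-cancel-<

0<i⇒¬0≤-i : ∀ {i} → + 0 < i → ¬ (+ 0 ≤ - i)
0<i⇒¬0≤-i 0<i = <⇒≱ (neg-mono-< 0<i)

0≤i⇒¬0<-i : ∀ {i} → + 0 ≤ i → ¬ (+ 0 < - i)
0≤i⇒¬0<-i 0≤i = ≤⇒≯ (neg-mono-≤ 0≤i)

0≤i*j : ∀ {i j} → + 0 ≤ i → + 0 ≤ j → + 0 ≤ i * j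
0≤i*j {i} {j} 0≤i 0≤j =
  subst (_≤ i * j) (*-zeroʳ i) (*-monoˡ-≤-nonNeg i ⦃ ℤ.nonNegative 0≤i ⦄ 0≤j)

0<i*j : ∀ {i j} → + 0 < i → + 0 < j → + 0 < i * j
0<i*j {i} {j} 0<i 0<j =
  subst (_< i * j) (*-zeroʳ i) (*-monoˡ-<-pos i ⦃ ℤ.positive 0<i ⦄ 0<j)

0≤+n*i : ∀ n {i} → + 0 ≤ i → + 0 ≤ + n * i
0≤+n*i n = 0≤i*j {+ n} (+≤+ z≤n)

0<k*i : ∀ k .⦃ _ : ℤ.Positive k ⦄ {i} → + 0 < i → + 0 < k * i
0<k*i k {i} 0<i = subst (_< k * i) (*-zeroʳ k) (*-monoˡ-<-pos k 0<i)

0<i+j⇒0<i⊎0<j : ∀ {i j} → + 0 ≤ j → + 0 < i + j → + 0 < i ⊎ + 0 < j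
0<i+j⇒0<i⊎0<j {i} {j} 0≤j 0<i+j with + 0 <? i
... | yes 0<i = inj₁ 0<i
... | no  0≮i =
  inj₂ (<-≤-trans 0<i+j (subst (i + j ≤_) (+-identityˡ j) (+-monoˡ-≤ j (≮⇒≥ 0≮i))))

neg-square : ∀ i → - i * - i ≡ i * i
neg-square i = solve (i ∷ [])

square-mono-≤ : ∀ {i j} → + 0 ≤ i → i ≤ j → i * i ≤ j * j
square-mono-≤ {i} {j} 0≤i i≤j =
  ≤-trans (*-monoˡ-≤-nonNeg i ⦃ ℤ.nonNegative 0≤i ⦄ i≤j)
          (*-monoʳ-≤-nonNeg j ⦃ ℤ.nonNegative (≤-trans 0≤i i≤j) ⦄ i≤j)

square-antimono-≤ : ∀ {i j} → j ≤ + 0 → i ≤ j → j * j ≤ i * i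
square-antimono-≤ {i} {j} j≤0 i≤j =
  subst₂ _≤_ (neg-square j) (neg-square i) (square-mono-≤ (neg-mono-≤ j≤0) (neg-mono-≤ i≤j))

PosSqrt5-monoˡ-≤ : ∀ {p p′ q} → p ≤ p′ → PosSqrt5 p q → PosSqrt5 p′ q
PosSqrt5-monoˡ-≤ p≤p′ (inj₁ (0≤p , 0≤q , pos)) =
  inj₁ (≤-trans 0≤p p≤p′ , 0≤q , Sum.map₁ (λ 0<p → <-≤-trans 0<p p≤p′) pos)
PosSqrt5-monoˡ-≤ p≤p′ (inj₂ (inj₁ ((0<p , q<0) , norm))) =
  inj₂ (inj₁ ((<-≤-trans 0<p p≤p′ , q<0) ,
              <-≤-trans norm (square-mono-≤ (<⇒≤ 0<p) p≤p′)))
PosSqrt5-monoˡ-≤ {p′ = p′} p≤p′ (inj₂ (inj₂ ((p<0 , 0<q) , norm))) with p′ <? + 0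
... | yes p′<0 =
  inj₂ (inj₂ ((p′<0 , 0<q) , ≤-<-trans (square-antimono-≤ (<⇒≤ p′<0) p≤p′) norm))
... | no  p′≮0 = inj₁ (≮⇒≥ p′≮0 , <⇒≤ 0<q , inj₂ 0<q)

PosSqrt5-asym : ∀ {p q} → PosSqrt5 p q → ¬ PosSqrt5 (- p) (- q)
PosSqrt5-asym (inj₁ (_ , _ , inj₁ 0<p)) (inj₁ (0≤-p , _ , _)) = 0<i⇒¬0≤-i 0<p 0≤-p
PosSqrt5-asym (inj₁ (_ , _ , inj₂ 0<q)) (inj₁ (_ , 0≤-q , _)) = 0<i⇒¬0≤-i 0<q 0≤-q
PosSqrt5-asym (inj₁ (0≤p , _ , _)) (inj₂ (inj₁ ((0<-p , _) , _))) = 0≤i⇒¬0<-i 0≤p 0<-p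
PosSqrt5-asym (inj₁ (_ , 0≤q , _)) (inj₂ (inj₂ ((_ , 0<-q) , _))) = 0≤i⇒¬0<-i 0≤q 0<-q
PosSqrt5-asym (inj₂ (inj₁ ((0<p , _) , _))) (inj₁ (0≤-p , _ , _)) = 0<i⇒¬0≤-i 0<p 0≤-p
PosSqrt5-asym (inj₂ (inj₁ ((0<p , _) , _))) (inj₂ (inj₁ ((0<-p , _) , _))) =
  0<i⇒¬0≤-i 0<p (<⇒≤ 0<-p)
PosSqrt5-asym {p} {q} (inj₂ (inj₁ (_ , norm))) (inj₂ (inj₂ (_ , norm′))) =
  <-asym norm (subst₂ _<_ (neg-square p) (cong (+ 5 *_) (neg-square q)) norm′)
PosSqrt5-asym (inj₂ (inj₂ ((_ , 0<q) , _))) (inj₁ (_ , 0≤-q , _)) = 0<i⇒¬0≤-i 0<q 0≤-q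
PosSqrt5-asym {p} {q} (inj₂ (inj₂ (_ , norm))) (inj₂ (inj₁ (_ , norm′))) =
  <-asym norm (subst₂ _<_ (cong (+ 5 *_) (neg-square q)) (neg-square p) norm′)
PosSqrt5-asym (inj₂ (inj₂ ((_ , 0<q) , _))) (inj₂ (inj₂ ((_ , 0<-q) , _))) =
  0<i⇒¬0≤-i 0<q (<⇒≤ 0<-q)

-- √5 - 1 has norm -4: N(5q - p, p - q) = -4 N(p, q) for N(p, q) = p² - 5q².
norm-*[√5-1]-< : ∀ p q → + 5 * (q * q) < p * p →
                 (+ 5 * q - p) * (+ 5 * q - p) < + 5 * ((p - q) * (p - q))
norm-*[√5-1]-< p q norm =
  0<i-j⇒j<i (0<-resp-≡ (0<k*i (+ 4) (i<j⇒0<j-i norm)) (solve (p ∷ q ∷ [])))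

norm-*[√5-1]-> : ∀ p q → p * p < + 5 * (q * q) →
                 + 5 * ((p - q) * (p - q)) < (+ 5 * q - p) * (+ 5 * q - p)
norm-*[√5-1]-> p q norm =
  0<i-j⇒j<i (0<-resp-≡ (0<k*i (+ 4) (i<j⇒0<j-i norm)) (solve (p ∷ q ∷ [])))

PosSqrt5-*[√5-1]-nonNeg : ∀ {p q} → + 0 ≤ p → + 0 ≤ q → + 0 < p ⊎ + 0 < q →
                          PosSqrt5 (+ 5 * q - p) (p - q)
PosSqrt5-*[√5-1]-nonNeg {p} {q} 0≤p 0≤q pos with p <? q | + 5 * q <? p
... | yes p<q | _ = inj₂ (inj₁ ((0<P , Q<0) , norm-*[√5-1]-> p q p²<5q²))
  where
  0<q-p : + 0 < q - p
  0<q-p = i<j⇒0<j-i p<q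
  0<P : + 0 < + 5 * q - p
  0<P = 0<-resp-≡ (+-mono-≤-< (0≤+n*i 4 0≤q) 0<q-p) (solve (p ∷ q ∷ []))
  Q<0 : p - q < + 0
  Q<0 = 0<-i⇒i<0 (0<-resp-≡ 0<q-p (solve (p ∷ q ∷ [])))
  0<q+p : + 0 < q + p
  0<q+p = +-mono-<-≤ (≤-<-trans 0≤p p<q) 0≤p
  p²<5q² : p * p < + 5 * (q * q)
  p²<5q² = 0<i-j⇒j<i (0<-resp-≡ (+-mono-<-≤ (0<i*j 0<q-p 0<q+p) (0≤+n*i 4 (0≤i*j 0≤q 0≤q)))
                                 (solve (p ∷ q ∷ [])))
... | no _ | yes 5q<p = inj₂ (inj₂ ((P<0 , 0<Q) , norm-*[√5-1]-< p q 5q²<p²))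
  where
  0<p-5q : + 0 < p - + 5 * q
  0<p-5q = i<j⇒0<j-i 5q<p
  P<0 : + 5 * q - p < + 0
  P<0 = 0<-i⇒i<0 (0<-resp-≡ 0<p-5q (solve (p ∷ q ∷ [])))
  0<Q : + 0 < p - q
  0<Q = 0<-resp-≡ (+-mono-<-≤ 0<p-5q (0≤+n*i 4 0≤q)) (solve (p ∷ q ∷ []))
  0<p+5q : + 0 < p + + 5 * q
  0<p+5q = +-mono-<-≤ (≤-<-trans (0≤+n*i 5 0≤q) 5q<p) (0≤+n*i 5 0≤q)
  5q²<p² : + 5 * (q * q) < p * p
  5q²<p² = 0<i-j⇒j<i (0<-resp-≡ (+-mono-<-≤ (0<i*j 0<p-5q 0<p+5q) (0≤+n*i 20 (0≤i*j 0≤q 0≤q)))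
                                 (solve (p ∷ q ∷ [])))
... | no p≮q | no 5q≮p = inj₁ (0≤P , 0≤Q , 0<i+j⇒0<i⊎0<j 0≤Q 0<P+Q)
  where
  0≤P : + 0 ≤ + 5 * q - p
  0≤P = i≤j⇒0≤j-i (≮⇒≥ 5q≮p)
  0≤Q : + 0 ≤ p - q
  0≤Q = i≤j⇒0≤j-i (≮⇒≥ p≮q)
  0<q : + 0 < q
  0<q = Sum.[ (λ 0<p → *-cancelˡ-<-nonNeg (+ 5) (<-≤-trans 0<p (≮⇒≥ 5q≮p))) , id ] pos
  0<P+Q : + 0 < (+ 5 * q - p) + (p - q)
  0<P+Q = 0<-resp-≡ (0<k*i (+ 4) 0<q) (solve (p ∷ q ∷ []))

PosSqrt5-*[√5-1] : ∀ {p q} → PosSqrt5 p q → PosSqrt5 (+ 5 * q - p) (p - q)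
PosSqrt5-*[√5-1] (inj₁ (0≤p , 0≤q , pos)) = PosSqrt5-*[√5-1]-nonNeg 0≤p 0≤q pos
PosSqrt5-*[√5-1] {p} {q} (inj₂ (inj₁ ((0<p , q<0) , norm))) =
  inj₂ (inj₂ ((P<0 , +-mono-< 0<p 0<-q) , norm-*[√5-1]-< p q norm))
  where
  0<-q : + 0 < - q
  0<-q = neg-mono-< q<0
  P<0 : + 5 * q - p < + 0
  P<0 = 0<-i⇒i<0 (0<-resp-≡ (+-mono-≤-< (0≤+n*i 5 (<⇒≤ 0<-q)) 0<p) (solve (p ∷ q ∷ [])))
PosSqrt5-*[√5-1] {p} {q} (inj₂ (inj₂ ((p<0 , 0<q) , norm))) =
  inj₂ (inj₁ ((+-mono-≤-< (0≤+n*i 5 (<⇒≤ 0<q)) 0<-p , Q<0) , norm-*[√5-1]-> p q norm))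
  where
  0<-p : + 0 < - p
  0<-p = neg-mono-< p<0
  Q<0 : p - q < + 0
  Q<0 = 0<-i⇒i<0 (0<-resp-≡ (+-mono-< 0<-p 0<q) (solve (p ∷ q ∷ [])))

PosSqrt5-≡ : ∀ {p p′ q q′} → PosSqrt5 p q → p ≡ p′ → q ≡ q′ → PosSqrt5 p′ q′
PosSqrt5-≡ pos refl refl = pos

module _ (k : ℤ) .⦃ _ : ℤ.Positive k ⦄ where

  private
    instance
      k-nonNeg : ℤ.NonNegative k
      k-nonNeg = ℤ.nonNegative (<⇒≤ (positive⁻¹ k))

    cancel-0≤ : ∀ {i} → + 0 ≤ k * i → + 0 ≤ i
    cancel-0≤ {i} = *-cancelˡ-≤-pos (+ 0) i k ∘ subst (_≤ k * i) (sym (*-zeroʳ k))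

    cancel-0< : ∀ {i} → + 0 < k * i → + 0 < i
    cancel-0< {i} = *-cancelˡ-<-nonNeg k ∘ subst (_< k * i) (sym (*-zeroʳ k))

    cancel-<0 : ∀ {i} → k * i < + 0 → i < + 0
    cancel-<0 {i} = *-cancelˡ-<-nonNeg k ∘ subst (k * i <_) (sym (*-zeroʳ k))

    cancel-k² : ∀ {i j} → k * (k * i) < k * (k * j) → i < j
    cancel-k² = *-cancelˡ-<-nonNeg k ∘ *-cancelˡ-<-nonNeg k

    square-* : ∀ i → (k * i) * (k * i) ≡ k * (k * (i * i))
    square-* i = solve (k ∷ i ∷ [])

    5*square-* : ∀ i → + 5 * ((k * i) * (k * i)) ≡ k * (k * (+ 5 * (i * i)))
    5*square-* i = solve (k ∷ i ∷ [])

  PosSqrt5-*-cancelˡ : ∀ {p q} → PosSqrt5 (k * p) (k * q) → PosSqrt5 p q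
  PosSqrt5-*-cancelˡ (inj₁ (0≤kp , 0≤kq , pos)) =
    inj₁ (cancel-0≤ 0≤kp , cancel-0≤ 0≤kq , Sum.map cancel-0< cancel-0< pos)
  PosSqrt5-*-cancelˡ {p} {q} (inj₂ (inj₁ ((0<kp , kq<0) , norm))) =
    inj₂ (inj₁ ((cancel-0< 0<kp , cancel-<0 kq<0) ,
                cancel-k² (subst₂ _<_ (5*square-* q) (square-* p) norm)))
  PosSqrt5-*-cancelˡ {p} {q} (inj₂ (inj₂ ((kp<0 , 0<kq) , norm))) =
    inj₂ (inj₂ ((cancel-<0 kp<0 , cancel-0< 0<kq) ,
                cancel-k² (subst₂ _<_ (square-* p) (5*square-* q) norm)))

φ₊ φ₊⁻¹ -1φ : Zφ
φ₊   = (+ 1) +φ (- + 1)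
φ₊⁻¹ = (+ 0) +φ (- + 1)
-1φ  = (- + 1) +φ (+ 0)

-- _<φ_ computes away its arguments, so Agda cannot infer them from a proof;
-- wrapping it in a record makes them recoverable.
record _≺_ (x y : Zφ) : Set where
  constructor ≺-intro
  field
    ≺⇒<φ : x <φ y

0≺φ₊⁻¹ : 0φ ≺ φ₊⁻¹
0≺φ₊⁻¹ = ≺-intro (inj₂ (inj₂ ((-<+ , +<+ (s≤s z≤n)) , +<+ (s≤s (s≤s z≤n)))))

-1≺0 : -1φ ≺ 0φ
-1≺0 = ≺-intro (inj₁ (+≤+ z≤n , +≤+ z≤n , inj₁ (+<+ (s≤s z≤n))))

≺-asym : ∀ {x y} → x ≺ y → ¬ y ≺ x
≺-asym {a +φ b} {c +φ d} (≺-intro x<y) (≺-intro y<x) = PosSqrt5-asym x<y (PosSqrt5-≡ y<x p≡ q≡)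
  where
  p≡ : + 2 * (a - c) + (b - d) ≡ - (+ 2 * (c - a) + (d - b))
  p≡ = solve (a ∷ b ∷ c ∷ d ∷ [])
  q≡ : - (b - d) ≡ - - (d - b)
  q≡ = solve (b ∷ d ∷ [])

≺-irrefl : ∀ {x} → ¬ x ≺ x
≺-irrefl x≺x = ≺-asym x≺x x≺x

Positive-⊕-nonNeg : ∀ {k} x → + 0 ≤ k → Positive x → Positive (x ⊕ (k +φ (+ 0)))
Positive-⊕-nonNeg {k} (a +φ b) 0≤k pos =
  PosSqrt5-≡ (PosSqrt5-monoˡ-≤ p≤p′ pos) refl (cong -_ (sym (+-identityʳ b)))
  where
  p≤p′ : + 2 * a + b ≤ + 2 * (a + k) + (b + + 0)
  p≤p′ = 0≤i-j⇒j≤i (0≤-resp-≡ (0≤+n*i 2 0≤k) (solve (a ∷ b ∷ k ∷ [])))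

≺-weakenʳ : ∀ {x y} → x ≺ y → x ≺ (y ⊕ 1φ)
≺-weakenʳ {a +φ b} {c +φ d} (≺-intro x<y) =
  ≺-intro (subst Positive (cong₂ _+φ_ (add c a (+ 1)) (add d b (+ 0)))
                          (Positive-⊕-nonNeg ((c +φ d) ⊖ (a +φ b)) (+≤+ z≤n) x<y))
  where
  add : ∀ j i k → j - i + k ≡ j + k - i
  add j i k = solve (j ∷ i ∷ k ∷ [])

≺-weakenˡ : ∀ {x y} → x ≺ y → (x ⊖ 1φ) ≺ y
≺-weakenˡ {a +φ b} {c +φ d} (≺-intro x<y) =
  ≺-intro (subst Positive (cong₂ _+φ_ (add c a (+ 1)) (add d b (+ 0)))
                          (Positive-⊕-nonNeg ((c +φ d) ⊖ (a +φ b)) (+≤+ z≤n) x<y))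
  where
  add : ∀ j i k → j - i + k ≡ j - (i - k)
  add j i k = solve (j ∷ i ∷ k ∷ [])

⊕-monoʳ-≺ : ∀ s {x y} → x ≺ y → (s ⊕ x) ≺ (s ⊕ y)
⊕-monoʳ-≺ (s₁ +φ s₂) {a +φ b} {c +φ d} (≺-intro x<y) =
  ≺-intro (subst Positive (cong₂ _+φ_ (shift s₁ a c) (shift s₂ b d)) x<y)
  where
  shift : ∀ s i j → j - i ≡ (s + j) - (s + i)
  shift s i j = solve (s ∷ i ∷ j ∷ [])

timesφ-antitone : ∀ {x y} → x ≺ y → timesφ y ≺ timesφ x
timesφ-antitone {a +φ b} {c +φ d} (≺-intro x<y) =
  ≺-intro (PosSqrt5-*-cancelˡ (+ 2) (PosSqrt5-≡ (PosSqrt5-*[√5-1] x<y) p≡ q≡))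
  where
  p≡ : + 5 * - (d - b) - (+ 2 * (c - a) + (d - b)) ≡ + 2 * (+ 2 * (b - d) + ((a + b) - (c + d)))
  p≡ = solve (a ∷ b ∷ c ∷ d ∷ [])
  q≡ : + 2 * (c - a) + (d - b) - - (d - b) ≡ + 2 * - ((a + b) - (c + d))
  q≡ = solve (a ∷ b ∷ c ∷ d ∷ [])

-- Tail values

digit : Arrow → Zφ
digit Inbound  = 1φ
digit Outbound = 0φ

-- tailValue c j m = Σ_{t < m} digit (c (j + t)) · φ₋^t, in Horner form.
tailValue : Config → ℕ → ℕ → Zφ
tailValue c j zero    = 0φ
tailValue c j (suc m) = digit (c j) ⊕ timesφ (tailValue c (suc j) m)

tailValue-bounds : ∀ c j m → -1φ ≺ tailValue c j m × tailValue c j m ≺ φ₊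
tailValue-bounds c j zero = -1≺0 , ≺-weakenʳ 0≺φ₊⁻¹
tailValue-bounds c j (suc m) with c j | tailValue-bounds c (suc j) m
... | Inbound  | lower , upper =
  ≺-weakenˡ (⊕-monoʳ-≺ 1φ (timesφ-antitone upper)) , ⊕-monoʳ-≺ 1φ (timesφ-antitone lower)
... | Outbound | lower , upper =
  ⊕-monoʳ-≺ 0φ (timesφ-antitone upper) , ≺-weakenʳ (⊕-monoʳ-≺ 0φ (timesφ-antitone lower))

tailValue-cong : ∀ {c d} j m → (∀ i → j ℕ.≤ i → c i ≡ d i) →
                 tailValue c j m ≡ tailValue d j m
tailValue-cong j zero    _   = refl
tailValue-cong j (suc m) c≗d =
  cong₂ (λ a u → digit a ⊕ timesφ u) (c≗d j ℕP.≤-refl)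
        (tailValue-cong (suc j) m (λ i j<i → c≗d i (ℕP.<⇒≤ j<i)))

⊕-assoc : ∀ x y z → (x ⊕ y) ⊕ z ≡ x ⊕ (y ⊕ z)
⊕-assoc (a +φ b) (c +φ d) (e +φ f) = cong₂ _+φ_ (assoc a c e) (assoc b d f)
  where
  assoc : ∀ i j k → (i + j) + k ≡ i + (j + k)
  assoc i j k = solve (i ∷ j ∷ k ∷ [])

timesφ-distrib-⊕ : ∀ x y → timesφ (x ⊕ y) ≡ timesφ x ⊕ timesφ y
timesφ-distrib-⊕ (a +φ b) (c +φ d) = cong ((b + d) +φ_) (interchange a c b d)
  where
  interchange : ∀ i j k l → (i + j) + (k + l) ≡ (i + k) + (j + l)
  interchange i j k l = solve (i ∷ j ∷ k ∷ l ∷ [])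

timesφ-contrib : ∀ a m → timesφ (contrib a m) ≡ contrib a (suc m)
timesφ-contrib Inbound  m = refl
timesφ-contrib Outbound m = refl

tailValue-snoc : ∀ c j m → tailValue c j (suc m) ≡ tailValue c j m ⊕ contrib (c (j ℕ.+ m)) m
tailValue-snoc c j zero rewrite ℕP.+-identityʳ j with c j
... | Inbound  = refl
... | Outbound = refl
tailValue-snoc c j (suc m) = begin
  digit (c j) ⊕ timesφ (tailValue c (suc j) (suc m))
    ≡⟨ cong (λ u → digit (c j) ⊕ timesφ u) (tailValue-snoc c (suc j) m) ⟩
  digit (c j) ⊕ timesφ (tailValue c (suc j) m ⊕ contrib (c (suc j ℕ.+ m)) m)
    ≡⟨ cong (digit (c j) ⊕_) (timesφ-distrib-⊕ (tailValue c (suc j) m) _) ⟩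
  digit (c j) ⊕ (timesφ (tailValue c (suc j) m) ⊕ timesφ (contrib (c (suc j ℕ.+ m)) m))
    ≡⟨ sym (⊕-assoc (digit (c j)) _ _) ⟩
  tailValue c j (suc m) ⊕ timesφ (contrib (c (suc j ℕ.+ m)) m)
    ≡⟨ cong (tailValue c j (suc m) ⊕_) (timesφ-contrib (c (suc j ℕ.+ m)) m) ⟩
  tailValue c j (suc m) ⊕ contrib (c (suc j ℕ.+ m)) (suc m)
    ≡⟨ cong (λ i → tailValue c j (suc m) ⊕ contrib (c i) (suc m)) (sym (ℕP.+-suc j m)) ⟩
  tailValue c j (suc m) ⊕ contrib (c (j ℕ.+ suc m)) (suc m) ∎
  where open ≡-Reasoning

value≡timesφ-tailValue : ∀ c n → value c n ≡ timesφ (tailValue c 1 n)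
value≡timesφ-tailValue c zero    = refl
value≡timesφ-tailValue c (suc n) = begin
  value c n ⊕ contrib (c (suc n)) (suc n)
    ≡⟨ cong₂ _⊕_ (value≡timesφ-tailValue c n) (sym (timesφ-contrib (c (suc n)) n)) ⟩
  timesφ (tailValue c 1 n) ⊕ timesφ (contrib (c (suc n)) n)
    ≡⟨ sym (timesφ-distrib-⊕ (tailValue c 1 n) _) ⟩
  timesφ (tailValue c 1 n ⊕ contrib (c (suc n)) n)
    ≡⟨ cong timesφ (sym (tailValue-snoc c 1 n)) ⟩
  timesφ (tailValue c 1 (suc n)) ∎
  where open ≡-Reasoning

-- Runs of the bug

flipAt-same : ∀ i c → flipAt i c i ≡ flipArrow (c i)
flipAt-same i c with i ℕP.≟ i
... | yes _   = refl
... | no  i≢i = contradiction refl i≢i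

flipAt-other : ∀ {i j} c → i ≢ j → flipAt i c j ≡ c j
flipAt-other {i} {j} c i≢j with i ℕP.≟ j
... | yes i≡j = contradiction i≡j i≢j
... | no  _   = refl

flipAt-below : ∀ {i j} c → j ℕ.< i → flipAt i c j ≡ c j
flipAt-below c j<i = flipAt-other c (ℕP.>⇒≢ j<i)

OutboundFrom : ℕ → Config → Set
OutboundFrom n c = ∀ i → n ℕ.≤ i → c i ≡ Outbound

flipAt-OutboundFrom : ∀ {i n c} → i ℕ.< n → OutboundFrom n c → OutboundFrom n (flipAt i c)
flipAt-OutboundFrom {c = c} i<n out j n≤j =
  trans (flipAt-other c (ℕP.<⇒≢ (ℕP.<-≤-trans i<n n≤j))) (out j n≤j)

run-+ : ∀ m n s → run (m ℕ.+ n) s ≡ run n (run m s)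
run-+ zero    n s = refl
run-+ (suc m) n s = run-+ m n (step s)

_↠_ : State → State → Set
s ↠ t = ∃ λ n → run n s ≡ t

↠-trans : ∀ {s t u} → s ↠ t → t ↠ u → s ↠ u
↠-trans {s} (m , refl) (n , refl) = m ℕ.+ n , run-+ m n s

step-site : ∀ k c → step (+ suc k , c) ≡ (hop (suc k) (flipArrow (c (suc k))) , flipAt (suc k) c)
step-site k c = cong (λ a → hop (suc k) a , flipAt (suc k) c) (flipAt-same (suc k) c)

record Excursion (k : ℕ) (c : Config) (z : ℤ) : Set where
  constructor excursion
  field
    final          : Config
    reaches        : (+ suc k , c) ↠ (z , final)
    unchangedBelow : ∀ i → i ℕ.< suc k → final i ≡ c i
open Excursion

excursion-Outbound : ∀ {k c} → c (suc k) ≡ Outbound → Excursion k c (+ suc k - + 2)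
excursion-Outbound {k} {c} out = excursion (flipAt (suc k) c) (1 , one-step) (λ i → flipAt-below c)
  where
  one-step : step (+ suc k , c) ≡ (+ suc k - + 2 , flipAt (suc k) c)
  one-step = trans (step-site k c) (cong (λ a → hop (suc k) (flipArrow a) , flipAt (suc k) c) out)

excursion-Inbound : ∀ {k c z} → c (suc k) ≡ Inbound →
                    Excursion (suc k) (flipAt (suc k) c) z → Excursion k c z
excursion-Inbound {k} {c} inb (excursion d reaches unchanged) =
  excursion d (↠-trans (1 , one-step) reaches)
            (λ i i<1+k → trans (unchanged i (ℕP.m<n⇒m<1+n i<1+k)) (flipAt-below c i<1+k))
  where
  one-step : step (+ suc k , c) ≡ (+ suc (suc k) , flipAt (suc k) c)
  one-step = begin
    step (+ suc k , c)                        ≡⟨ step-site k c ⟩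
    hop (suc k) (flipArrow (c (suc k))) , c′  ≡⟨ cong (λ a → hop (suc k) (flipArrow a) , c′) inb ⟩
    + (suc k ℕ.+ 1) , c′                      ≡⟨ cong (λ n → + n , c′) (ℕP.+-comm (suc k) 1) ⟩
    + suc (suc k) , c′                        ∎
    where
    open ≡-Reasoning
    c′ : Config
    c′ = flipAt (suc k) c

tailValue-flipAt : ∀ {i j} c m → i ℕ.< j → tailValue (flipAt i c) j m ≡ tailValue c j m
tailValue-flipAt c m i<j =
  tailValue-cong _ m (λ l j≤l → flipAt-other c (ℕP.<⇒≢ (ℕP.<-≤-trans i<j j≤l)))

excursion-++ : ∀ {k c z} (e : Excursion k c (+ suc k)) → Excursion k (final e) z → Excursion k c z
excursion-++ (excursion d reaches unchanged) (excursion d′ reaches′ unchanged′) =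
  excursion d′ (↠-trans reaches reaches′)
               (λ i i<1+k → trans (unchanged′ i i<1+k) (unchanged i i<1+k))

exit : ∀ m k c → OutboundFrom (suc k ℕ.+ m) c →
         (φ₊⁻¹ ≺ tailValue c (suc k) m × Excursion k c (+ suc k - + 1))
       ⊎ (tailValue c (suc k) m ≺ φ₊⁻¹ × Excursion k c (+ suc k - + 2))
exit zero k c out =
  inj₂ (0≺φ₊⁻¹ , excursion-Outbound (out (suc k) (ℕP.≤-reflexive (ℕP.+-identityʳ (suc k)))))
exit (suc m) k c out with c (suc k) in arrow
... | Outbound = inj₂ (⊕-monoʳ-≺ 0φ (timesφ-antitone lower) , excursion-Outbound arrow)
  where
  lower : -1φ ≺ tailValue c (suc (suc k)) m
  lower = proj₁ (tailValue-bounds c (suc (suc k)) m)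
... | Inbound with exit m (suc k) (flipAt (suc k) c) out′ | tailValue-flipAt c m (ℕP.n<1+n (suc k))
  where
  out′ : OutboundFrom (suc (suc k) ℕ.+ m) (flipAt (suc k) c)
  out′ = flipAt-OutboundFrom (ℕP.m≤m+n (suc (suc k)) m)
           (subst (λ n → OutboundFrom n c) (cong suc (ℕP.+-suc k m)) out)
...   | inj₁ (φ₊⁻¹≺T , e) | same-tail =
  inj₂ (⊕-monoʳ-≺ 1φ (timesφ-antitone (subst (φ₊⁻¹ ≺_) same-tail φ₊⁻¹≺T)) ,
        excursion-++ (excursion-Inbound arrow e) (excursion-Outbound returns-Outbound))
  where
  returns-Outbound : final e (suc k) ≡ Outbound
  returns-Outbound = trans (unchangedBelow e (suc k) (ℕP.n<1+n (suc k)))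
                           (trans (flipAt-same (suc k) c) (cong flipArrow arrow))
...   | inj₂ (T≺φ₊⁻¹ , e) | same-tail =
  inj₁ (⊕-monoʳ-≺ 1φ (timesφ-antitone (subst (_≺ φ₊⁻¹) same-tail T≺φ₊⁻¹)) ,
        excursion-Inbound arrow e)

excursion⇒LandsIn : ∀ {c z} → Excursion 0 c z → LandsIn z c
excursion⇒LandsIn (excursion _ (n , reaches) _) = n , cong proj₁ reaches

split-by-≺ : ∀ {x y} {A B : Set} → (x ≺ y × A) ⊎ (y ≺ x × B) →
             ¬ x ≡ y × (x <φ y → A) × (y <φ x → B)
split-by-≺ (inj₁ (x≺y , a)) =
  (λ { refl → ≺-irrefl x≺y }) , const a , (λ y<x → ⊥-elim (≺-asym x≺y (≺-intro y<x)))
split-by-≺ (inj₂ (y≺x , b)) =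
  (λ { refl → ≺-irrefl y≺x }) , (λ x<y → ⊥-elim (≺-asym y≺x (≺-intro x<y))) , const b

mainTheorem3 : (c : Config) (N : ℕ) → InboundBoundedBy c N →
    (¬ (value c N ≡ threshold))
    × (value c N <φ threshold → LandsIn (+ 0) c)
    × (threshold <φ value c N → LandsIn -[1+ 0 ] c)
mainTheorem3 c N bounded = split-by-≺ (Sum.map toZero toMinusOne (exit N 0 c bounded))
  where
  V≡ψT : value c N ≡ timesφ (tailValue c 1 N)
  V≡ψT = value≡timesφ-tailValue c N
  toZero : φ₊⁻¹ ≺ tailValue c 1 N × Excursion 0 c (+ 0) →
           value c N ≺ threshold × LandsIn (+ 0) c
  toZero = Product.map (subst (_≺ threshold) (sym V≡ψT) ∘ timesφ-antitone) excursion⇒LandsIn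
  toMinusOne : tailValue c 1 N ≺ φ₊⁻¹ × Excursion 0 c -[1+ 0 ] →
               threshold ≺ value c N × LandsIn -[1+ 0 ] c
  toMinusOne = Product.map (subst (threshold ≺_) (sym V≡ψT) ∘ timesφ-antitone) excursion⇒LandsIn
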